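{- Let $p>q\geq1$ be integers and let $u_\beta$ be the unique fixed point of the morphism $\varphi(0)=0^p1$, $\varphi(1)=0^q1$ on $\{0,1\}^*$. Let $T(x)=0^q1\varphi(x)0^q$. Let $w$ be a factor of $u_\beta$ containing exactly one letter $1$, having maximal index $\mathrm{ind}(w)$ among all factors of $u_\beta$ of length $|w|$, and such that $\mathrm{ind}(w)\geq p\geq 3$. Let $k=\lfloor\mathrm{ind}(w)\rfloor$ and let $v=w^kw'$ be the maximal power of $w$ in $u_\beta$. Then $$w=0^q1\,\varphi(0)\,(0^q1)^{ -1},\qquad v=T(0^p),\qquad \mathrm{ind}(w)=p+\frac{2q+1}{p+1}.$$
   Context: For a rational $r\geq1$, a word $y$ is the $r$-th power of $w$ if $y=w^{\lfloor r\rfloor}w''$ with $w''$ a proper prefix of $w$ and $r=\lfloor r\rfloor+|w''|/|w|$. The index of a factor $w$ in $u_\beta$ is $\mathrm{ind}(w)=\max\{r\in\mathbb Q: w^r \text{ is a factor of } u_\beta\}$ (this maximum exists since $u_\beta$ is aperiodic and uniformly recurrent), and $w^{\mathrm{ind}(w)}$ is the maximal power of $w$. For $y=y'z$, $yz^{ -1}=y'$. -}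

module Defs where

open import Data.Nat using (ℕ; zero; suc; _+_; _*_; _≤_)
open import Data.List using (List; []; _∷_; _++_; concatMap; replicate; take; concat; length)
open import Data.Product using (∃; ∃-syntax; _×_)
open import Relation.Binary.PropositionalEquality using (_≡_)

data Letter : Set where
  𝟎 𝟏 : Letter

Word : Set
Word = List Letter

zeros : ℕ → Word
zeros n = replicate n 𝟎

φ : ℕ → ℕ → Letter → Word
φ p q 𝟎 = zeros p ++ (𝟏 ∷ [])
φ p q 𝟏 = zeros q ++ (𝟏 ∷ [])

φ* : ℕ → ℕ → Word → Word
φ* p q = concatMap (φ p q)

-- φ^n(0); these are the prefixes of the fixed point u_β = lim φ^n(0)
φⁿ0 : ℕ → ℕ → ℕ → Word
φⁿ0 p q zero    = 𝟎 ∷ []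
φⁿ0 p q (suc n) = φ* p q (φⁿ0 p q n)

-- w is a factor of u_β (every factor of u_β lies in some prefix φ^n(0))
Factor : ℕ → ℕ → Word → Set
Factor p q w = ∃[ n ] ∃[ x ] ∃[ y ] (x ++ w ++ y ≡ φⁿ0 p q n)

count1 : Word → ℕ
count1 []       = 0
count1 (𝟎 ∷ w)  = count1 w
count1 (𝟏 ∷ w)  = suc (count1 w)

-- pow w m : the power w^(m/|w|), i.e. the prefix of length m of w w w ...
-- (for m ≥ |w| this is w^⌊r⌋ w'' with r = m/|w|)
pow : Word → ℕ → Word
pow w m = take m (concat (replicate (suc m) w))

-- the rational r = m/|w| (m ≥ |w|) is the index of w: w^r is a factor of u_β
-- and it is maximal among such powers
IsIndexLen : ℕ → ℕ → Word → ℕ → Set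
IsIndexLen p q w m =
  length w ≤ m × Factor p q (pow w m) ×
  (∀ m' → length w ≤ m' → Factor p q (pow w m') → m' ≤ m)

T : ℕ → ℕ → Word → Word
T p q x = zeros q ++ (𝟏 ∷ []) ++ φ* p q x ++ zeros q

module Submission where

-- A word with a single 1 is w = 0ᵃ 1 0ᵇ, and its cube contains 1 0ᵇ⁺ᵃ 1 0ᵇ⁺ᵃ 1. In the
-- preimage under φ both gaps come from the same letter, and it must be 0 because 11 is not a factor;
-- hence a + b = p and the powers of w read 0ᵃ 1 φ(0ᵏ) 0ʲ (j ≤ p). The word 0^q 1 0^(p-q) has T(0ᵖ)
-- as its power of length M = p(p+1)+2q+1, so maximality of the index gives m ≥ M. Conversely,
-- desubstituting 1 φ(0ᵏ) 0^(q+1) yields 0ᵏ⁺¹, and 0^(q+1) 1 φ(0ᵏ) 0^(q+1) yields 0ᵏ⁺², while 0ᵖ⁺¹ is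
-- not a factor. With k = p this bounds m by a + p(p+1) + q + 1, which forces a ≥ q; with k = p-1 it
-- excludes a > q. So a = q and m = M, where the power is exactly T(0ᵖ).

open import Defs
open import Data.Nat using (ℕ; zero; suc; pred; _+_; _*_; _∸_; _⊓_; _≤_; _<_; s≤s; z<s; >-nonZero)
open import Data.Nat.Properties
open import Data.Nat.Tactic.RingSolver using (solve-∀)
open import Data.List using (List; []; _∷_; _++_; length; take; drop; concat; replicate)
open import Data.List.Properties
  using (++-assoc; ++-identityʳ; ++-cancelʳ; ++-monoid; length-++; length-++-comm; length-replicate;
         take-all; take-take; take++drop≡id; concatMap-++; ∷-injective; ∷-injectiveʳ)
open import Data.Product using (_×_; _,_; ∃-syntax)
open import Data.Sum using (_⊎_; inj₁; inj₂)
open import Data.Empty using (⊥-elim)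
open import Relation.Nullary using (¬_)
open import Relation.Binary.PropositionalEquality
open import Algebra.Solver.Monoid (++-monoid Letter) using (solve; _⊜_; _⊕_; id)

module _ {a} {A : Set a} where

  take-++ˡ : ∀ n (xs ys : List A) → n ≤ length xs → take n (xs ++ ys) ≡ take n xs
  take-++ˡ zero    xs       ys _         = refl
  take-++ˡ (suc n) (x ∷ xs) ys (s≤s n≤) = cong (x ∷_) (take-++ˡ n xs ys n≤)

  take-length-++ : ∀ (xs : List A) n ys → take (length xs + n) (xs ++ ys) ≡ xs ++ take n ys
  take-length-++ []       n ys = refl
  take-length-++ (x ∷ xs) n ys = cong (x ∷_) (take-length-++ xs n ys)

  take-replicate : ∀ {j n} (x : A) → j ≤ n → take j (replicate n x) ≡ replicate j x
  take-replicate {zero}          x _          = refl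
  take-replicate {suc j} {suc n} x (s≤s j≤n) = cong (x ∷_) (take-replicate x j≤n)

  replicate-+ : ∀ i j (x : A) → replicate i x ++ replicate j x ≡ replicate (i + j) x
  replicate-+ zero    j x = refl
  replicate-+ (suc i) j x = cong (x ∷_) (replicate-+ i j x)

  copies : ℕ → List A → List A
  copies j xs = concat (replicate j xs)

  length-copies : ∀ j (xs : List A) → length (copies j xs) ≡ j * length xs
  length-copies zero    xs = refl
  length-copies (suc j) xs = trans (length-++ xs) (cong (length xs +_) (length-copies j xs))

  copies-+ : ∀ i j (xs : List A) → copies (i + j) xs ≡ copies i xs ++ copies j xs
  copies-+ zero    j xs = refl
  copies-+ (suc i) j xs = trans (cong (xs ++_) (copies-+ i j xs)) (sym (++-assoc xs (copies i xs) _))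

  copies-conjugate : ∀ j (xs ys : List A) → copies (suc j) (xs ++ ys) ≡ xs ++ copies j (ys ++ xs) ++ ys
  copies-conjugate zero    xs ys = ++-identityʳ (xs ++ ys)
  copies-conjugate (suc j) xs ys = begin
    (xs ++ ys) ++ copies (suc j) (xs ++ ys)  ≡⟨ cong ((xs ++ ys) ++_) (copies-conjugate j xs ys) ⟩
    (xs ++ ys) ++ xs ++ C ++ ys              ≡⟨ ++-assoc xs ys _ ⟩
    xs ++ ys ++ xs ++ C ++ ys                ≡⟨ cong (xs ++_) (++-assoc ys xs (C ++ ys)) ⟨
    xs ++ (ys ++ xs) ++ C ++ ys              ≡⟨ cong (xs ++_) (++-assoc (ys ++ xs) C ys) ⟨
    xs ++ ((ys ++ xs) ++ C) ++ ys            ∎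
    where
    open ≡-Reasoning
    C = copies j (ys ++ xs)

  take-copies : ∀ {n} i j (xs : List A) → n ≤ i * length xs → n ≤ j * length xs →
                take n (copies i xs) ≡ take n (copies j xs)
  take-copies {n} i j xs n≤i n≤j = begin
    take n (copies i xs)                   ≡⟨ take-++ˡ n _ (copies j xs) (≤-length i n≤i) ⟨
    take n (copies i xs ++ copies j xs)    ≡⟨ cong (take n) (copies-+ i j xs) ⟨
    take n (copies (i + j) xs)             ≡⟨ cong (λ k → take n (copies k xs)) (+-comm i j) ⟩
    take n (copies (j + i) xs)             ≡⟨ cong (take n) (copies-+ j i xs) ⟩
    take n (copies j xs ++ copies i xs)    ≡⟨ take-++ˡ n _ (copies i xs) (≤-length j n≤j) ⟩
    take n (copies j xs)                   ∎
    where
    open ≡-Reasoning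
    ≤-length : ∀ k → n ≤ k * length xs → n ≤ length (copies k xs)
    ≤-length k = subst (n ≤_) (sym (length-copies k xs))

n≤suc[n]*ℓ : ∀ n {ℓ} → 0 < ℓ → n ≤ suc n * ℓ
n≤suc[n]*ℓ n 0<ℓ = ≤-trans (n≤1+n n) (m≤m*n (suc n) _ {{>-nonZero 0<ℓ}})

zeros-∷ʳ : ∀ n → zeros n ++ 𝟎 ∷ [] ≡ zeros (suc n)
zeros-∷ʳ zero    = refl
zeros-∷ʳ (suc n) = cong (𝟎 ∷_) (zeros-∷ʳ n)

module _ {w : Word} (0<|w| : 0 < length w) where

  pow≡take-copies : ∀ {n} j → n ≤ j * length w → pow w n ≡ take n (copies j w)
  pow≡take-copies {n} j = take-copies (suc n) j w (n≤suc[n]*ℓ n 0<|w|)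

  pow-prefix : ∀ {n m} → n ≤ m → pow w m ≡ pow w n ++ drop n (pow w m)
  pow-prefix {n} {m} n≤m = begin
    pow w m                                      ≡⟨ take++drop≡id n (pow w m) ⟨
    take n (pow w m) ++ drop n (pow w m)         ≡⟨ cong (_++ drop n (pow w m)) take-pow ⟩
    pow w n ++ drop n (pow w m)                  ∎
    where
    open ≡-Reasoning
    take-pow : take n (pow w m) ≡ pow w n
    take-pow = begin
      take n (take m (copies (suc m) w))  ≡⟨ take-take n m _ ⟩
      take (n ⊓ m) (copies (suc m) w)     ≡⟨ cong (λ k → take k (copies (suc m) w)) (m≤n⇒m⊓n≡m n≤m) ⟩
      take n (copies (suc m) w)           ≡⟨ pow≡take-copies (suc m) (≤-trans n≤m (n≤suc[n]*ℓ m 0<|w|)) ⟨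
      pow w n                             ∎

  pow-length : pow w (length w) ≡ w
  pow-length = trans (pow≡take-copies 1 (≤-reflexive (sym (*-identityˡ _))))
                     (trans (take-all _ _ (≤-reflexive (trans (length-copies 1 w) (*-identityˡ _)))) (++-identityʳ w))

pow-conjugate : ∀ (x y : Word) → 0 < length (x ++ y) → ∀ n →
                pow (x ++ y) (length x + n) ≡ x ++ pow (y ++ x) n
pow-conjugate x y 0<|xy| n = begin
  pow (x ++ y) (length x + n)                                 ≡⟨ pow≡take-copies 0<|xy| (suc (suc n)) bound ⟩
  take (length x + n) (copies (suc (suc n)) (x ++ y))         ≡⟨ cong (take (length x + n)) (copies-conjugate (suc n) x y) ⟩
  take (length x + n) (x ++ copies (suc n) (y ++ x) ++ y)     ≡⟨ take-length-++ x n _ ⟩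
  x ++ take n (copies (suc n) (y ++ x) ++ y)                  ≡⟨ cong (x ++_) (take-++ˡ n _ y short) ⟩
  x ++ pow (y ++ x) n                                         ∎
  where
  open ≡-Reasoning
  0<|yx| : 0 < length (y ++ x)
  0<|yx| = subst (0 <_) (length-++-comm x y) 0<|xy|
  bound : length x + n ≤ suc (suc n) * length (x ++ y)
  bound = +-mono-≤ (subst (length x ≤_) (sym (length-++ x)) (m≤m+n _ _)) (n≤suc[n]*ℓ n 0<|xy|)
  short : n ≤ length (copies (suc n) (y ++ x))
  short = subst (n ≤_) (sym (length-copies (suc n) (y ++ x))) (n≤suc[n]*ℓ n 0<|yx|)

block : ℕ → ℕ → Word
block a b = zeros a ++ 𝟏 ∷ zeros b

length-block : ∀ a b → length (block a b) ≡ suc (b + a)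
length-block a b = begin
  length (block a b)                         ≡⟨ length-++ (zeros a) ⟩
  length (zeros a) + suc (length (zeros b))  ≡⟨ cong₂ (λ i j → i + suc j) (length-replicate a) (length-replicate b) ⟩
  a + suc b                                  ≡⟨ +-suc a b ⟩
  suc (a + b)                                ≡⟨ cong suc (+-comm a b) ⟩
  suc (b + a)                                ∎
  where open ≡-Reasoning

0<length-block : ∀ a b → 0 < length (block a b)
0<length-block a b = subst (0 <_) (sym (length-block a b)) z<s

count1≡0⇒zeros : ∀ w → count1 w ≡ 0 → w ≡ zeros (length w)
count1≡0⇒zeros []      _  = refl
count1≡0⇒zeros (𝟎 ∷ w) c≡ = cong (𝟎 ∷_) (count1≡0⇒zeros w c≡)

count1≡1⇒block : ∀ w → count1 w ≡ 1 → ∃[ a ] ∃[ b ] w ≡ block a b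
count1≡1⇒block (𝟎 ∷ w) c≡ with count1≡1⇒block w c≡
... | a , b , w≡ = suc a , b , cong (𝟎 ∷_) w≡
count1≡1⇒block (𝟏 ∷ w) c≡ = 0 , length w , cong (𝟏 ∷_) (count1≡0⇒zeros w (suc-injective c≡))

zeros-𝟏≢[] : ∀ n {Y : Word} → zeros n ++ 𝟏 ∷ Y ≢ []
zeros-𝟏≢[] zero    ()
zeros-𝟏≢[] (suc n) ()

zeros-𝟏-injective : ∀ i j {A B : Word} → zeros i ++ 𝟏 ∷ A ≡ zeros j ++ 𝟏 ∷ B → i ≡ j × A ≡ B
zeros-𝟏-injective zero    zero    refl = refl , refl
zeros-𝟏-injective (suc i) (suc j) eq with zeros-𝟏-injective i j (∷-injectiveʳ eq)
... | i≡j , A≡B = cong suc i≡j , A≡B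

zeros≢zeros-𝟏 : ∀ {n j} (Y R : Word) → j ≤ n → zeros (suc n) ++ Y ≢ zeros j ++ 𝟏 ∷ R
zeros≢zeros-𝟏 {suc n} {suc j} Y R (s≤s j≤n) eq = zeros≢zeros-𝟏 Y R j≤n (∷-injectiveʳ eq)

zeros-𝟏-∷ʳ-𝟎 : ∀ n (R X : Word) → zeros n ++ 𝟏 ∷ R ≡ X ++ 𝟎 ∷ [] → ∃[ X' ] R ≡ X' ++ 𝟎 ∷ []
zeros-𝟏-∷ʳ-𝟎 zero    R (_ ∷ X) eq = X , ∷-injectiveʳ eq
zeros-𝟏-∷ʳ-𝟎 (suc n) R []      eq = ⊥-elim (zeros-𝟏≢[] n (∷-injectiveʳ eq))
zeros-𝟏-∷ʳ-𝟎 (suc n) R (_ ∷ X) eq = zeros-𝟏-∷ʳ-𝟎 n R X (∷-injectiveʳ eq)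

split-zeros-𝟏 : ∀ k (X S R : Word) → X ++ S ≡ zeros k ++ 𝟏 ∷ R →
  (∃[ X' ] X ≡ zeros k ++ 𝟏 ∷ X' × R ≡ X' ++ S) ⊎
  (∃[ i ] ∃[ j ] i + j ≡ k × X ≡ zeros i × S ≡ zeros j ++ 𝟏 ∷ R)
split-zeros-𝟏 k       []      S R eq = inj₂ (0 , k , refl , refl , eq)
split-zeros-𝟏 zero    (x ∷ X) S R eq with ∷-injective eq
... | refl , R≡ = inj₁ (X , refl , sym R≡)
split-zeros-𝟏 (suc k) (x ∷ X) S R eq with ∷-injective eq
... | refl , eq' with split-zeros-𝟏 k X S R eq'
... | inj₁ (X' , X≡ , R≡)           = inj₁ (X' , cong (𝟎 ∷_) X≡ , R≡)
... | inj₂ (i , j , i+j≡ , X≡ , S≡) = inj₂ (suc i , j , cong suc i+j≡ , cong (𝟎 ∷_) X≡ , S≡)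

module Substitution (p q : ℕ) where

  zeroRun : Letter → ℕ
  zeroRun 𝟎 = p
  zeroRun 𝟏 = q

  φ*-∷ : ∀ c t → φ* p q (c ∷ t) ≡ zeros (zeroRun c) ++ 𝟏 ∷ φ* p q t
  φ*-∷ 𝟎 t = ++-assoc (zeros p) (𝟏 ∷ []) (φ* p q t)
  φ*-∷ 𝟏 t = ++-assoc (zeros q) (𝟏 ∷ []) (φ* p q t)

  φ*-++ : ∀ (x y : Word) → φ* p q (x ++ y) ≡ φ* p q x ++ φ* p q y
  φ*-++ = concatMap-++ (φ p q)

  length-φ*-zeros : ∀ k → length (φ* p q (zeros k)) ≡ k * suc p
  length-φ*-zeros zero    = refl
  length-φ*-zeros (suc k) = begin
    length (φ* p q (zeros (suc k)))                     ≡⟨ cong length (φ*-∷ 𝟎 (zeros k)) ⟩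
    length (zeros p ++ 𝟏 ∷ φ* p q (zeros k))            ≡⟨ length-++ (zeros p) ⟩
    length (zeros p) + suc (length (φ* p q (zeros k)))  ≡⟨ cong₂ (λ i j → i + suc j) (length-replicate p) (length-φ*-zeros k) ⟩
    p + suc (k * suc p)                                 ≡⟨ +-suc p _ ⟩
    suc p + k * suc p                                   ∎
    where open ≡-Reasoning

  copies-𝟏-zeros : ∀ k → copies (suc k) (𝟏 ∷ zeros p) ≡ 𝟏 ∷ φ* p q (zeros k) ++ zeros p
  copies-𝟏-zeros zero    = ++-identityʳ (𝟏 ∷ zeros p)
  copies-𝟏-zeros (suc k) = cong (𝟏 ∷_) (begin
    zeros p ++ copies (suc k) (𝟏 ∷ zeros p)       ≡⟨ cong (zeros p ++_) (copies-𝟏-zeros k) ⟩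
    zeros p ++ 𝟏 ∷ φ* p q (zeros k) ++ zeros p    ≡⟨ ++-assoc (zeros p) (𝟏 ∷ φ* p q (zeros k)) (zeros p) ⟨
    (zeros p ++ 𝟏 ∷ φ* p q (zeros k)) ++ zeros p  ≡⟨ cong (_++ zeros p) (φ*-∷ 𝟎 (zeros k)) ⟨
    φ* p q (zeros (suc k)) ++ zeros p             ∎)
    where open ≡-Reasoning

  pow-𝟏-zeros : ∀ k {j} → j ≤ p → pow (𝟏 ∷ zeros p) (suc (k * suc p + j)) ≡ 𝟏 ∷ φ* p q (zeros k) ++ zeros j
  pow-𝟏-zeros k {j} j≤p = begin
    pow (𝟏 ∷ zeros p) (suc (k * suc p + j))                        ≡⟨ pow≡take-copies z<s (suc k) bound ⟩
    take (suc (k * suc p + j)) (copies (suc k) (𝟏 ∷ zeros p))      ≡⟨ cong (take (suc (k * suc p + j))) (copies-𝟏-zeros k) ⟩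
    𝟏 ∷ take (k * suc p + j) (φ* p q (zeros k) ++ zeros p)         ≡⟨ cong (λ i → 𝟏 ∷ take (i + j) (φ* p q (zeros k) ++ zeros p)) (length-φ*-zeros k) ⟨
    𝟏 ∷ take (length (φ* p q (zeros k)) + j) (φ* p q (zeros k) ++ zeros p)  ≡⟨ cong (𝟏 ∷_) (take-length-++ (φ* p q (zeros k)) j (zeros p)) ⟩
    𝟏 ∷ φ* p q (zeros k) ++ take j (zeros p)                        ≡⟨ cong (λ z → 𝟏 ∷ φ* p q (zeros k) ++ z) (take-replicate 𝟎 j≤p) ⟩
    𝟏 ∷ φ* p q (zeros k) ++ zeros j                                 ∎
    where
    open ≡-Reasoning
    bound : suc (k * suc p + j) ≤ suc k * length (𝟏 ∷ zeros p)
    bound = subst (λ ℓ → suc (k * suc p + j) ≤ suc k * suc ℓ) (sym (length-replicate p))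
              (s≤s (subst (_≤ p + k * suc p) (+-comm j _) (+-monoˡ-≤ _ j≤p)))

  φ*-head : ∀ {n Y t} → zeros n ++ 𝟏 ∷ Y ≡ φ* p q t →
            ∃[ d ] ∃[ t' ] t ≡ d ∷ t' × zeroRun d ≡ n × Y ≡ φ* p q t'
  φ*-head {n} {t = []}    eq = ⊥-elim (zeros-𝟏≢[] n eq)
  φ*-head {n} {t = d ∷ t} eq with zeros-𝟏-injective n (zeroRun d) (trans eq (φ*-∷ d t))
  ... | n≡ , Y≡ = d , t , refl , sym n≡ , Y≡

  φ*-desubstitute : ∀ (X s t : Word) → X ++ 𝟏 ∷ s ≡ φ* p q t →
    ∃[ t₁ ] ∃[ c ] ∃[ t₂ ] t ≡ t₁ ++ c ∷ t₂ × X ≡ φ* p q t₁ ++ zeros (zeroRun c) × s ≡ φ* p q t₂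
  φ*-desubstitute X s []      eq = ⊥-elim (∷≢[] X eq)
    where
    ∷≢[] : ∀ (X : Word) → X ++ 𝟏 ∷ s ≢ []
    ∷≢[] []      ()
    ∷≢[] (_ ∷ _) ()
  φ*-desubstitute X s (c ∷ t) eq with split-zeros-𝟏 (zeroRun c) X (𝟏 ∷ s) (φ* p q t) (trans eq (φ*-∷ c t))
  ... | inj₂ (i , zero , i+0≡ , X≡ , S≡) =
    [] , c , t , refl , trans X≡ (cong zeros (trans (sym (+-identityʳ i)) i+0≡)) , ∷-injectiveʳ S≡
  ... | inj₂ (i , suc j , _ , _ , ())
  ... | inj₁ (X' , X≡ , φ*t≡) with φ*-desubstitute X' s t (sym φ*t≡)
  ... | t₁ , c' , t₂ , t≡ , X'≡ , s≡ = c ∷ t₁ , c' , t₂ , cong (c ∷_) t≡ , X≡′ , s≡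
    where
    open ≡-Reasoning
    X≡′ : X ≡ φ* p q (c ∷ t₁) ++ zeros (zeroRun c')
    X≡′ = begin
      X                                                          ≡⟨ X≡ ⟩
      zeros (zeroRun c) ++ 𝟏 ∷ X'                                ≡⟨ cong (λ z → zeros (zeroRun c) ++ 𝟏 ∷ z) X'≡ ⟩
      zeros (zeroRun c) ++ 𝟏 ∷ φ* p q t₁ ++ zeros (zeroRun c')   ≡⟨ ++-assoc (zeros (zeroRun c)) _ _ ⟨
      (zeros (zeroRun c) ++ 𝟏 ∷ φ* p q t₁) ++ zeros (zeroRun c') ≡⟨ cong (_++ zeros (zeroRun c')) (φ*-∷ c t₁) ⟨
      φ* p q (c ∷ t₁) ++ zeros (zeroRun c')                      ∎

  φ*≢∷ʳ𝟎 : ∀ t (X : Word) → φ* p q t ≢ X ++ 𝟎 ∷ []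
  φ*≢∷ʳ𝟎 []      []      ()
  φ*≢∷ʳ𝟎 []      (_ ∷ _) ()
  φ*≢∷ʳ𝟎 (c ∷ t) X eq with zeros-𝟏-∷ʳ-𝟎 (zeroRun c) (φ* p q t) X (trans (sym (φ*-∷ c t)) eq)
  ... | X' , φ*t≡ = φ*≢∷ʳ𝟎 t X' φ*t≡

  φ*-no-long-zeros : q ≤ p → ∀ U (X Y : Word) → X ++ zeros (suc p) ++ Y ≢ φ* p q U
  φ*-no-long-zeros q≤p []      []      Y ()
  φ*-no-long-zeros q≤p []      (_ ∷ _) Y ()
  φ*-no-long-zeros q≤p (c ∷ U) X Y eq
    with split-zeros-𝟏 (zeroRun c) X (zeros (suc p) ++ Y) (φ* p q U) (trans eq (φ*-∷ c U))
  ... | inj₁ (X' , _ , φ*U≡) = φ*-no-long-zeros q≤p U X' Y (sym φ*U≡)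
  ... | inj₂ (i , j , i+j≡ , _ , S≡) =
    zeros≢zeros-𝟏 Y (φ* p q U) (≤-trans (subst (j ≤_) i+j≡ (m≤n+m j i)) (zeroRun≤p c)) S≡
    where
    zeroRun≤p : ∀ c → zeroRun c ≤ p
    zeroRun≤p 𝟎 = ≤-refl
    zeroRun≤p 𝟏 = q≤p

  module _ (p≢q : p ≢ q) where

    zeroRun-injective : ∀ c d → zeroRun c ≡ zeroRun d → c ≡ d
    zeroRun-injective 𝟎 𝟎 _ = refl
    zeroRun-injective 𝟎 𝟏 e = ⊥-elim (p≢q e)
    zeroRun-injective 𝟏 𝟎 e = ⊥-elim (p≢q (sym e))
    zeroRun-injective 𝟏 𝟏 _ = refl

    φ*-prefix-cancel : ∀ t (Z V : Word) → φ* p q t ++ Z ≡ φ* p q V → ∃[ V' ] V ≡ t ++ V' × Z ≡ φ* p q V'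
    φ*-prefix-cancel []      Z V eq = V , refl , eq
    φ*-prefix-cancel (c ∷ t) Z V eq
      with φ*-head {t = V} (trans (sym (trans (cong (_++ Z) (φ*-∷ c t)) (++-assoc (zeros (zeroRun c)) _ Z))) eq)
    ... | d , V₁ , refl , run≡ , φ*t++Z≡ with zeroRun-injective d c run≡
    ... | refl with φ*-prefix-cancel t Z V₁ φ*t++Z≡
    ... | V' , V₁≡ , Z≡ = V' , cong (d ∷_) V₁≡ , Z≡

    -- φ(1) = 0^q 1 has only q zeros, so a block of q+1 zeros after φ*(t) must come from a letter 0.
    φ*-desubstitute-run : ∀ (X t Y U : Word) → X ++ 𝟏 ∷ φ* p q t ++ zeros (suc q) ++ Y ≡ φ* p q U →
      ∃[ t₁ ] ∃[ c ] ∃[ t₂ ] U ≡ t₁ ++ c ∷ t ++ 𝟎 ∷ t₂ × X ≡ φ* p q t₁ ++ zeros (zeroRun c)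
    φ*-desubstitute-run X t Y U eq with φ*-desubstitute X _ U eq
    ... | t₁ , c , t₂ , U≡ , X≡ , s≡ with φ*-prefix-cancel t (zeros (suc q) ++ Y) t₂ s≡
    ... | [] , _ , ()
    ... | 𝟏 ∷ V , _ , Z≡ = ⊥-elim (zeros≢zeros-𝟏 Y (φ* p q V) ≤-refl (trans Z≡ (φ*-∷ 𝟏 V)))
    ... | 𝟎 ∷ V , t₂≡ , _ = t₁ , c , V , trans U≡ (cong (λ z → t₁ ++ c ∷ z) t₂≡) , X≡

module Factors (p q : ℕ) where
  open Substitution p q

  factor-infix : ∀ x s y {w} → x ++ s ++ y ≡ w → Factor p q w → Factor p q s
  factor-infix x s y refl (n , X , Y , eq) =
    n , X ++ x , y ++ Y ,
    trans (solve 5 (λ X x s y Y → (X ⊕ x) ⊕ s ⊕ (y ⊕ Y) ⊜ X ⊕ (x ⊕ s ⊕ y) ⊕ Y) refl X x s y Y) eq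

  factor-φ* : ∀ {s} → Factor p q s → Factor p q (φ* p q s)
  factor-φ* {s} (n , X , Y , eq) = suc n , φ* p q X , φ* p q Y , (begin
    φ* p q X ++ φ* p q s ++ φ* p q Y    ≡⟨ cong (φ* p q X ++_) (φ*-++ s Y) ⟨
    φ* p q X ++ φ* p q (s ++ Y)         ≡⟨ φ*-++ X (s ++ Y) ⟨
    φ* p q (X ++ s ++ Y)                ≡⟨ cong (φ* p q) eq ⟩
    φ* p q (φⁿ0 p q n)                  ∎)
    where open ≡-Reasoning

  factor-pow-prefix : ∀ {w n m} → 0 < length w → n ≤ m → Factor p q (pow w m) → Factor p q (pow w n)
  factor-pow-prefix {w} {n} {m} 0<|w| n≤m = factor-infix [] _ (drop n (pow w m)) (sym (pow-prefix 0<|w| n≤m))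

  factor-pow⇒factor : ∀ {w m} → 0 < length w → length w ≤ m → Factor p q (pow w m) → Factor p q w
  factor-pow⇒factor 0<|w| |w|≤m f = subst (Factor p q) (pow-length 0<|w|) (factor-pow-prefix 0<|w| |w|≤m f)

  -- The fixed point starts with 0^p 1, so an occurrence in φ⁰(0) = 0 also lies in φ(φ⁰(0)).
  factor-in-image : 0 < p → ∀ {w} → Factor p q w → ∃[ n ] ∃[ X ] ∃[ Y ] X ++ w ++ Y ≡ φ* p q (φⁿ0 p q n)
  factor-in-image 0<p     (suc n , occurrence) = n , occurrence
  factor-in-image 0<p {w} (zero , X , Y , eq) = 0 , X , Y ++ R , (begin
    X ++ w ++ Y ++ R                ≡⟨ solve 4 (λ X w Y R → X ⊕ w ⊕ Y ⊕ R ⊜ (X ⊕ w ⊕ Y) ⊕ R) refl X w Y R ⟩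
    (X ++ w ++ Y) ++ R              ≡⟨ cong (_++ R) eq ⟩
    zeros (suc (pred p)) ++ 𝟏 ∷ []  ≡⟨ cong (λ k → zeros k ++ 𝟏 ∷ []) (suc-pred p {{>-nonZero 0<p}}) ⟩
    zeros p ++ 𝟏 ∷ []               ≡⟨ ++-identityʳ _ ⟨
    φ* p q (𝟎 ∷ [])                 ∎)
    where
    open ≡-Reasoning
    R = zeros (pred p) ++ 𝟏 ∷ []

module FixedPoint (p q : ℕ) (1≤q : 1 ≤ q) (q<p : q < p) where
  open Substitution p q
  open Factors p q

  q≤p : q ≤ p
  q≤p = <⇒≤ q<p

  p≢q : p ≢ q
  p≢q = ≢-sym (<⇒≢ q<p)

  0<p : 0 < p
  0<p = m<n⇒0<n q<p

  zeroRun≢0 : ∀ d → zeroRun d ≢ 0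
  zeroRun≢0 𝟎 = m<n⇒n≢0 q<p
  zeroRun≢0 𝟏 = m<n⇒n≢0 1≤q

  ¬factor-zeros : ¬ Factor p q (zeros (suc p))
  ¬factor-zeros f with factor-in-image 0<p f
  ... | n , X , Y , eq = φ*-no-long-zeros q≤p (φⁿ0 p q n) X Y eq

  ¬factor-𝟏𝟏 : ¬ Factor p q (𝟏 ∷ 𝟏 ∷ [])
  ¬factor-𝟏𝟏 f with factor-in-image 0<p f
  ... | n , X , Y , eq with φ*-desubstitute X (𝟏 ∷ Y) (φⁿ0 p q n) eq
  ... | _ , _ , t₂ , _ , _ , s≡ with φ*-head {n = 0} {t = t₂} s≡
  ... | d , _ , _ , run≡0 , _ = zeroRun≢0 d run≡0

  factor-gap : ∀ n → Factor p q (𝟏 ∷ zeros n ++ 𝟏 ∷ zeros n ++ 𝟏 ∷ []) → n ≡ p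
  factor-gap n f with factor-in-image 0<p f
  ... | N , X , Y , eq with φ*-desubstitute X _ (φⁿ0 p q N) eq
  ... | t₁ , c , t₂ , U≡ , _ , s≡ with φ*-head {t = t₂} (trans (sym (++-assoc (zeros n) _ Y)) s≡)
  ... | d , t₃ , refl , run≡ , rest≡ with φ*-head {t = t₃} (trans (sym (++-assoc (zeros n) _ Y)) rest≡)
  ... | d' , t₄ , refl , run'≡ , _ with zeroRun-injective p≢q d d' (trans run≡ (sym run'≡))
  ... | refl with d
  ... | 𝟎 = sym run≡
  ... | 𝟏 = ⊥-elim (¬factor-𝟏𝟏 (N , t₁ ++ c ∷ [] , t₄ , trans (++-assoc t₁ (c ∷ []) _) (sym U≡)))

  factor-𝟏φ*zeros⇒ : ∀ t → Factor p q (𝟏 ∷ φ* p q t ++ zeros (suc q)) → Factor p q (t ++ 𝟎 ∷ [])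
  factor-𝟏φ*zeros⇒ t f with factor-in-image 0<p f
  ... | N , X , Y , eq
    with φ*-desubstitute-run p≢q X t Y (φⁿ0 p q N)
           (trans (cong (λ s → X ++ 𝟏 ∷ s) (sym (++-assoc (φ* p q t) _ Y))) eq)
  ... | t₁ , c , t₂ , U≡ , _ =
    N , t₁ ++ c ∷ [] , t₂ ,
    trans (solve 5 (λ t₁ c t₂ t o → (t₁ ⊕ c) ⊕ (t ⊕ o) ⊕ t₂ ⊜ t₁ ⊕ c ⊕ t ⊕ o ⊕ t₂) refl t₁ (c ∷ []) t₂ t (𝟎 ∷ []))
          (sym U≡)

  factor-zeros𝟏φ*zeros⇒ : ∀ t → Factor p q (zeros (suc q) ++ 𝟏 ∷ φ* p q t ++ zeros (suc q)) →
                          Factor p q (𝟎 ∷ t ++ 𝟎 ∷ [])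
  factor-zeros𝟏φ*zeros⇒ t f with factor-in-image 0<p f
  ... | N , X , Y , eq with φ*-desubstitute-run p≢q (X ++ zeros (suc q)) t Y (φⁿ0 p q N) (trans reassoc eq)
    where
    reassoc : (X ++ zeros (suc q)) ++ 𝟏 ∷ φ* p q t ++ zeros (suc q) ++ Y ≡
              X ++ (zeros (suc q) ++ 𝟏 ∷ φ* p q t ++ zeros (suc q)) ++ Y
    reassoc = solve 6 (λ X Z o F Z' Y → (X ⊕ Z) ⊕ o ⊕ F ⊕ Z' ⊕ Y ⊜ X ⊕ (Z ⊕ o ⊕ F ⊕ Z') ⊕ Y)
                refl X (zeros (suc q)) (𝟏 ∷ []) (φ* p q t) (zeros (suc q)) Y
  ... | t₁ , 𝟎 , t₂ , U≡ , _ = N , t₁ , t₂ , trans (cong (λ z → t₁ ++ 𝟎 ∷ z) (++-assoc t _ t₂)) (sym U≡)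
  ... | t₁ , 𝟏 , t₂ , _ , X≡ =
    ⊥-elim (φ*≢∷ʳ𝟎 t₁ X (sym (++-cancelʳ (zeros q) (X ++ 𝟎 ∷ []) _ (trans (++-assoc X (𝟎 ∷ []) (zeros q)) X≡))))

  -- 00 occurs in φ(0) = 0ᵖ1, so 1 0ᵖ 1 occurs in φ(00), and T(0ᵖ) in φ(1 0ᵖ 1).
  factor-T-zeros : Factor p q (T p q (zeros p))
  factor-T-zeros =
    factor-infix [] (T p q (zeros p)) (𝟏 ∷ []) φ[𝟏0ᵖ𝟏]≡ (factor-φ* (factor-infix (zeros p) _ [] φ[𝟎𝟎]≡ (factor-φ* factor-𝟎𝟎)))
    where
    open ≡-Reasoning
    factor-𝟎𝟎 : Factor p q (𝟎 ∷ 𝟎 ∷ [])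
    factor-𝟎𝟎 = 1 , [] , (zeros (p ∸ 2) ++ 𝟏 ∷ []) ++ [] ,
      cong (λ k → (zeros k ++ 𝟏 ∷ []) ++ []) (m+[n∸m]≡n (≤-trans (s≤s 1≤q) q<p))
    φ[𝟎𝟎]≡ : zeros p ++ (𝟏 ∷ zeros p ++ 𝟏 ∷ []) ++ [] ≡ φ* p q (𝟎 ∷ 𝟎 ∷ [])
    φ[𝟎𝟎]≡ = solve 2 (λ Z o → Z ⊕ (o ⊕ Z ⊕ o) ⊕ id ⊜ (Z ⊕ o) ⊕ (Z ⊕ o) ⊕ id) refl (zeros p) (𝟏 ∷ [])
    φ[𝟏0ᵖ𝟏]≡ : [] ++ T p q (zeros p) ++ 𝟏 ∷ [] ≡ φ* p q (𝟏 ∷ zeros p ++ 𝟏 ∷ [])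
    φ[𝟏0ᵖ𝟏]≡ = begin
      T p q (zeros p) ++ 𝟏 ∷ []
        ≡⟨ solve 4 (λ Q o F R → (Q ⊕ o ⊕ F ⊕ Q) ⊕ o ⊜ (Q ⊕ o) ⊕ F ⊕ ((Q ⊕ o) ⊕ id)) refl (zeros q) (𝟏 ∷ []) (φ* p q (zeros p)) [] ⟩
      (zeros q ++ 𝟏 ∷ []) ++ φ* p q (zeros p) ++ φ* p q (𝟏 ∷ [])
        ≡⟨ cong ((zeros q ++ 𝟏 ∷ []) ++_) (φ*-++ (zeros p) (𝟏 ∷ [])) ⟨
      φ* p q (𝟏 ∷ zeros p ++ 𝟏 ∷ [])
        ∎

block-++-zeros-𝟏 : ∀ p q {a b} → b + a ≡ p → block a b ++ zeros a ++ 𝟏 ∷ [] ≡ zeros a ++ 𝟏 ∷ [] ++ φ p q 𝟎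
block-++-zeros-𝟏 p q {a} {b} b+a≡p = begin
  block a b ++ zeros a ++ 𝟏 ∷ []                  ≡⟨ solve 3 (λ A o B → (A ⊕ o ⊕ B) ⊕ A ⊕ o ⊜ A ⊕ o ⊕ (B ⊕ A) ⊕ o) refl (zeros a) (𝟏 ∷ []) (zeros b) ⟩
  zeros a ++ 𝟏 ∷ [] ++ (zeros b ++ zeros a) ++ 𝟏 ∷ [] ≡⟨ cong (λ z → zeros a ++ 𝟏 ∷ [] ++ z ++ 𝟏 ∷ []) (trans (replicate-+ b a 𝟎) (cong zeros b+a≡p)) ⟩
  zeros a ++ 𝟏 ∷ [] ++ φ p q 𝟎                    ∎
  where open ≡-Reasoning

-- ind(w)·|w| = (p + (2q+1)/(p+1))·(p+1) = |T(0ᵖ)|.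
maxPowerLength : ℕ → ℕ → ℕ
maxPowerLength p q = p * (p + 1) + (2 * q + 1)

maxPowerLength-split : ∀ p q → maxPowerLength p q ≡ q + suc (p * suc p + q)
maxPowerLength-split p q = eq p q
  where
  eq : ∀ p q → p * (p + 1) + (2 * q + 1) ≡ q + suc (p * suc p + q)
  eq = solve-∀

maxPowerLength<⇒q≤a : ∀ p q a → maxPowerLength p q < a + suc (p * suc p + suc q) → q ≤ a
maxPowerLength<⇒q≤a p q a lt = ≤-pred (+-cancelˡ-≤ (p * suc p + suc q) _ _ (subst₂ _≤_ (lhs p q) (rhs p q a) lt))
  where
  lhs : ∀ p q → suc (p * (p + 1) + (2 * q + 1)) ≡ (p * suc p + suc q) + suc q
  lhs = solve-∀
  rhs : ∀ p q a → a + suc (p * suc p + suc q) ≡ (p * suc p + suc q) + suc a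
  rhs = solve-∀

<suc-maxPowerLength⇒≤ : ∀ p q m → m < q + suc (p * suc p + suc q) → m ≤ maxPowerLength p q
<suc-maxPowerLength⇒≤ p q m lt = ≤-pred (subst (m <_) (eq p q) lt)
  where
  eq : ∀ p q → q + suc (p * suc p + suc q) ≡ suc (p * (p + 1) + (2 * q + 1))
  eq = solve-∀

≤maxPowerLength : ∀ {p} k q a → suc k ≡ p → a ≤ p → a + suc (k * suc p + suc q) ≤ maxPowerLength p q
≤maxPowerLength k q a refl a≤p = ≤-trans (+-monoˡ-≤ _ a≤p) (≤-trans (m≤m+n _ q) (≤-reflexive (eq k q)))
  where
  eq : ∀ k q → (suc k + suc (k * suc (suc k) + suc q)) + q ≡ suc k * (suc k + 1) + (2 * q + 1)
  eq = solve-∀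

suc≤maxPowerLength : ∀ p q → suc p ≤ maxPowerLength p q
suc≤maxPowerLength p q = subst (suc p ≤_) (eq p q) (s≤s (m≤m+n p _))
  where
  eq : ∀ p q → suc (p + (p * p + 2 * q)) ≡ p * (p + 1) + (2 * q + 1)
  eq = solve-∀

module MaximalPower (p q : ℕ) (1≤q : 1 ≤ q) (q<p : q < p) where
  open Substitution p q
  open Factors p q
  open FixedPoint p q 1≤q q<p

  M : ℕ
  M = maxPowerLength p q

  MaximalAmongSameLength : Word → ℕ → Set
  MaximalAmongSameLength w m = ∀ (w' : Word) (m' : ℕ) → length w' ≡ length w → Factor p q w' →
    length w' ≤ m' → Factor p q (pow w' m') → m' * length w ≤ m * length w'

  block-period : ∀ {a b n} → 3 * length (block a b) ≤ n → Factor p q (pow (block a b) n) → b + a ≡ p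
  block-period {a} {b} 3|w|≤n f = factor-gap (b + a) (factor-infix (zeros a) _ (zeros b) w³≡ f³)
    where
    open ≡-Reasoning
    w = block a b
    f³ : Factor p q (copies 3 w)
    f³ = subst (Factor p q)
           (trans (pow≡take-copies {w = w} (0<length-block a b) 3 ≤-refl) (take-all _ _ (≤-reflexive (length-copies 3 w))))
           (factor-pow-prefix {w = w} (0<length-block a b) 3|w|≤n f)
    w³≡ : zeros a ++ (𝟏 ∷ zeros (b + a) ++ 𝟏 ∷ zeros (b + a) ++ 𝟏 ∷ []) ++ zeros b ≡ copies 3 w
    w³≡ = begin
      zeros a ++ (𝟏 ∷ zeros (b + a) ++ 𝟏 ∷ zeros (b + a) ++ 𝟏 ∷ []) ++ zeros b
        ≡⟨ cong (λ z → zeros a ++ (𝟏 ∷ z ++ 𝟏 ∷ z ++ 𝟏 ∷ []) ++ zeros b) (replicate-+ b a 𝟎) ⟨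
      zeros a ++ (𝟏 ∷ (zeros b ++ zeros a) ++ 𝟏 ∷ (zeros b ++ zeros a) ++ 𝟏 ∷ []) ++ zeros b
        ≡⟨ solve 3 (λ A o B → A ⊕ (o ⊕ (B ⊕ A) ⊕ o ⊕ (B ⊕ A) ⊕ o) ⊕ B ⊜ (A ⊕ o ⊕ B) ⊕ (A ⊕ o ⊕ B) ⊕ (A ⊕ o ⊕ B) ⊕ id)
             refl (zeros a) (𝟏 ∷ []) (zeros b) ⟩
      copies 3 w
        ∎

  module BlockWord (a b : ℕ) (b+a≡p : b + a ≡ p) where

    w : Word
    w = block a b

    pow-block : ∀ k {j} → j ≤ p → pow w (a + suc (k * suc p + j)) ≡ zeros a ++ 𝟏 ∷ φ* p q (zeros k) ++ zeros j
    pow-block k {j} j≤p = begin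
      pow w (a + n)                                  ≡⟨ cong (λ i → pow w (i + n)) (length-replicate a) ⟨
      pow w (length (zeros a) + n)                   ≡⟨ pow-conjugate (zeros a) (𝟏 ∷ zeros b) (0<length-block a b) n ⟩
      zeros a ++ pow (𝟏 ∷ zeros b ++ zeros a) n      ≡⟨ cong (λ z → zeros a ++ pow (𝟏 ∷ z) n) (trans (replicate-+ b a 𝟎) (cong zeros b+a≡p)) ⟩
      zeros a ++ pow (𝟏 ∷ zeros p) n                 ≡⟨ cong (zeros a ++_) (pow-𝟏-zeros k j≤p) ⟩
      zeros a ++ 𝟏 ∷ φ* p q (zeros k) ++ zeros j     ∎
      where
      open ≡-Reasoning
      n = suc (k * suc p + j)

    factor-pow-block : ∀ k {n} → a + suc (k * suc p + suc q) ≤ n → Factor p q (pow w n) →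
                       Factor p q (zeros a ++ 𝟏 ∷ φ* p q (zeros k) ++ zeros (suc q))
    factor-pow-block k bound≤n f =
      subst (Factor p q) (pow-block k q<p) (factor-pow-prefix (0<length-block a b) bound≤n f)

    factor-pow⇒zeros : ∀ k {n} → a + suc (k * suc p + suc q) ≤ n → Factor p q (pow w n) → Factor p q (zeros (suc k))
    factor-pow⇒zeros k bound≤n f =
      subst (Factor p q) (zeros-∷ʳ k)
        (factor-𝟏φ*zeros⇒ (zeros k) (factor-infix (zeros a) _ [] (cong (zeros a ++_) (++-identityʳ _))
          (factor-pow-block k bound≤n f)))

    -- When a > q the run 0ᵃ also supplies q+1 zeros in front of the 1.
    factor-pow⇒zeros-both : q < a → ∀ k {n} → a + suc (k * suc p + suc q) ≤ n → Factor p q (pow w n) →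
                            Factor p q (zeros (suc (suc k)))
    factor-pow⇒zeros-both q<a k bound≤n f =
      subst (Factor p q) (cong (𝟎 ∷_) (zeros-∷ʳ k))
        (factor-zeros𝟏φ*zeros⇒ (zeros k) (factor-infix (zeros (a ∸ suc q)) _ [] split-run (factor-pow-block k bound≤n f)))
      where
      open ≡-Reasoning
      Z = zeros (suc q)
      R = φ* p q (zeros k) ++ zeros (suc q)
      split-run : zeros (a ∸ suc q) ++ (Z ++ 𝟏 ∷ R) ++ [] ≡ zeros a ++ 𝟏 ∷ R
      split-run = begin
        zeros (a ∸ suc q) ++ (Z ++ 𝟏 ∷ R) ++ []   ≡⟨ cong (zeros (a ∸ suc q) ++_) (++-identityʳ _) ⟩
        zeros (a ∸ suc q) ++ Z ++ 𝟏 ∷ R           ≡⟨ ++-assoc (zeros (a ∸ suc q)) Z _ ⟨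
        (zeros (a ∸ suc q) ++ Z) ++ 𝟏 ∷ R         ≡⟨ cong (_++ 𝟏 ∷ R) (trans (replicate-+ (a ∸ suc q) (suc q) 𝟎) (cong zeros (m∸n+n≡m q<a))) ⟩
        zeros a ++ 𝟏 ∷ R                          ∎

  pow-T : ∀ b → b + q ≡ p → pow (block q b) M ≡ T p q (zeros p)
  pow-T b b+q≡p = trans (cong (pow (block q b)) (maxPowerLength-split p q)) (BlockWord.pow-block q b b+q≡p p q≤p)

  maximal⇒M≤m : ∀ {a b m} → b + a ≡ p → MaximalAmongSameLength (block a b) m → M ≤ m
  maximal⇒M≤m {a} {b} {m} b+a≡p maximal =
    *-cancelʳ-≤ M m (suc p) (subst₂ (λ i j → M * i ≤ m * j) |w|≡ |w₀|≡
      (maximal w₀ M (trans |w₀|≡ (sym |w|≡)) factor-w₀ |w₀|≤M factor-pow-w₀))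
    where
    w₀ = block q (p ∸ q)
    |w|≡ : length (block a b) ≡ suc p
    |w|≡ = trans (length-block a b) (cong suc b+a≡p)
    |w₀|≡ : length w₀ ≡ suc p
    |w₀|≡ = trans (length-block q (p ∸ q)) (cong suc (m∸n+n≡m q≤p))
    |w₀|≤M : length w₀ ≤ M
    |w₀|≤M = subst (_≤ M) (sym |w₀|≡) (suc≤maxPowerLength p q)
    factor-pow-w₀ : Factor p q (pow w₀ M)
    factor-pow-w₀ = subst (Factor p q) (sym (pow-T (p ∸ q) (m∸n+n≡m q≤p))) factor-T-zeros
    factor-w₀ : Factor p q w₀
    factor-w₀ = factor-pow⇒factor (0<length-block q (p ∸ q)) |w₀|≤M factor-pow-w₀

  maximal-block-power : 3 ≤ p → ∀ a b m → Factor p q (pow (block a b) m) → p * length (block a b) ≤ m →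
                  MaximalAmongSameLength (block a b) m → a ≡ q × b + a ≡ p × m ≡ M
  maximal-block-power 3≤p a b m f p|w|≤m maximal = a≡q , b+a≡p , ≤-antisym m≤M M≤m
    where
    b+a≡p : b + a ≡ p
    b+a≡p = block-period {a} {b} (≤-trans (*-monoˡ-≤ (length (block a b)) 3≤p) p|w|≤m) f
    open BlockWord a b b+a≡p
    M≤m : M ≤ m
    M≤m = maximal⇒M≤m {a} {b} b+a≡p maximal
    m<bound : m < a + suc (p * suc p + suc q)
    m<bound = ≰⇒> (λ bound≤m → ¬factor-zeros (factor-pow⇒zeros p bound≤m f))
    q≮a : ¬ q < a
    q≮a q<a = ¬factor-zeros (subst (λ k → Factor p q (zeros (suc k))) p≡
      (factor-pow⇒zeros-both q<a (pred p) (≤-trans (≤maxPowerLength (pred p) q a p≡ a≤p) M≤m) f))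
      where
      p≡ : suc (pred p) ≡ p
      p≡ = suc-pred p {{>-nonZero 0<p}}
      a≤p : a ≤ p
      a≤p = subst (a ≤_) b+a≡p (m≤n+m a b)
    a≡q : a ≡ q
    a≡q = ≤-antisym (≮⇒≥ q≮a) (maxPowerLength<⇒q≤a p q a (≤-<-trans M≤m m<bound))
    m≤M : m ≤ M
    m≤M = <suc-maxPowerLength⇒≤ p q m (subst (λ i → m < i + suc (p * suc p + suc q)) a≡q m<bound)

  maximal-block-power-claims : ∀ {a b m} → a ≡ q × b + a ≡ p × m ≡ M →
    (block a b ++ zeros q ++ 𝟏 ∷ [] ≡ zeros q ++ 𝟏 ∷ [] ++ φ p q 𝟎)
      × (pow (block a b) m ≡ T p q (zeros p))
      × (m * (p + 1) ≡ M * length (block a b))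
  maximal-block-power-claims {b = b} (refl , b+q≡p , refl) =
    block-++-zeros-𝟏 p q b+q≡p , pow-T b b+q≡p ,
    cong (M *_) (trans (+-comm p 1) (sym (trans (length-block q b) (cong suc b+q≡p))))

mainTheorem5 : (p q : ℕ) → 1 ≤ q → q < p → 3 ≤ p →
    (w : Word) (m : ℕ) →
    Factor p q w → count1 w ≡ 1 →
    IsIndexLen p q w m →
    (∀ (w' : Word) (m' : ℕ) → length w' ≡ length w → Factor p q w' →
      length w' ≤ m' → Factor p q (pow w' m') → m' * length w ≤ m * length w') →
    p * length w ≤ m →
    (w ++ (zeros q ++ (𝟏 ∷ [])) ≡ zeros q ++ (𝟏 ∷ []) ++ φ p q 𝟎)
      × (pow w m ≡ T p q (zeros p))
      × (m * (p + 1) ≡ (p * (p + 1) + (2 * q + 1)) * length w)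
mainTheorem5 p q 1≤q q<p 3≤p w m _ one-𝟏 (_ , f , _) maximal p|w|≤m with count1≡1⇒block w one-𝟏
... | a , b , refl = maximal-block-power-claims (maximal-block-power 3≤p a b m f p|w|≤m maximal)
  where open MaximalPower p q 1≤q q<p
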